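{- Let $G$ be a connected finite directed graph on $[n]$ such that $\mathcal{A}_G$ is terminal and reflexive. Then each proper face of $\mathcal{A}_G$ is of the form $\mathcal{A}_H$ for some directed subgraph $H$ of $G$ that is acyclic (has no directed cycles).
   Context: $\mathcal{A}_G=\operatorname{conv}\{\mathbf{e}_i-\mathbf{e}_j:(i,j)\in A(G)\}\subset\mathbb{R}^n$ is the directed edge polytope; for a subgraph $H$, $\mathcal{A}_H$ is defined analogously from $A(H)$. A lattice polytope is called terminal and reflexive if it contains the origin in its relative interior and is unimodularly equivalent to a full-dimensional polytope whose vertices are primitive, whose only boundary lattice points are vertices, and whose facets have lattice distance one from the origin. (For directed edge polytopes this holds iff every directed edge of $G$ lies on a directed cycle.)
   Formalization: The polytopes $\mathcal{A}_G$ and $\mathcal{A}_H$ and all their faces are taken in ℚⁿ, with rational convex combinations and faces cut out by rational functionals, rather than in ℝⁿ. -}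

module Defs where

open import Data.Nat using (ℕ; zero; suc; _≥_)
open import Data.Integer using (ℤ; +_)
open import Data.Rational using (ℚ; _+_; _*_; _-_; _≤_; 0ℚ; 1ℚ; _/_)
open import Data.Fin using (Fin; zero; suc; _≟_)
open import Data.Bool using (Bool; true; false)
open import Data.Product using (Σ; ∃; _×_; _,_)
open import Data.Empty using (⊥)
open import Relation.Nullary using (¬_; yes; no)
open import Relation.Binary.PropositionalEquality using (_≡_)
open import Relation.Binary.Construct.Closure.ReflexiveTransitive using (Star)
open import Relation.Binary.Construct.Closure.Symmetric using (SymClosure)
open import Relation.Binary.Construct.Closure.Transitive using (TransClosure)

record Digraph (n : ℕ) : Set where
  field
    arc    : Fin n → Fin n → Bool
    noLoop : ∀ i → arc i i ≡ false
open Digraph public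

Arc : ∀ {n} → Digraph n → Fin n → Fin n → Set
Arc G i j = arc G i j ≡ true

_⊆G_ : ∀ {n} → Digraph n → Digraph n → Set
H ⊆G G = ∀ i j → Arc H i j → Arc G i j

Connected : ∀ {n} → Digraph n → Set
Connected G = ∀ i j → Star (SymClosure (Arc G)) i j

Acyclic : ∀ {n} → Digraph n → Set
Acyclic G = ∀ i → ¬ TransClosure (Arc G) i i

Pt : ℕ → Set
Pt n = Fin n → ℚ

sumF : ∀ {n} → (Fin n → ℚ) → ℚ
sumF {zero}  f = 0ℚ
sumF {suc n} f = f zero + sumF (λ k → f (suc k))

_·_ : ∀ {n} → Pt n → Pt n → ℚ
c · x = sumF (λ k → c k * x k)

e : ∀ {n} → Fin n → Pt n
e i k with k ≟ i
... | yes _ = 1ℚ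
... | no  _ = 0ℚ

eij : ∀ {n} → Fin n → Fin n → Pt n
eij i j k = e i k - e j k

𝟎 : ∀ {n} → Pt n
𝟎 k = 0ℚ

PSet : ℕ → Set₁
PSet n = Pt n → Set

-- The directed edge polytope
--   𝒜_G = conv { e_i - e_j : (i,j) ∈ A(G) }
-- x ∈ 𝒜_G iff x is a convex combination (rational coefficients) of the
-- points e_i - e_j with (i,j) an arc of G.

EdgePolytope : ∀ {n} → Digraph n → PSet n
EdgePolytope {n} G x =
  Σ (Fin n → Fin n → ℚ) λ λ' →
      (∀ i j → 0ℚ ≤ λ' i j)
    × (∀ i j → arc G i j ≡ false → λ' i j ≡ 0ℚ)
    × (sumF (λ i → sumF (λ j → λ' i j)) ≡ 1ℚ)
    × (∀ k → x k ≡ sumF (λ i → sumF (λ j → λ' i j * eij i j k)))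

-- Faces of a polytope P ⊆ ℚⁿ:
-- F is a face of P iff there are c ∈ ℚⁿ, b ∈ ℚ with c·x ≤ b valid on P
-- and F = { x ∈ P : c·x = b }.  (Includes ∅ and P itself.)

IsFace : ∀ {n} → PSet n → PSet n → Set
IsFace {n} P F =
  Σ (Pt n) λ c → Σ ℚ λ b →
      (∀ x → P x → (c · x) ≤ b)
    × (∀ x → (F x → P x × (c · x) ≡ b) × (P x × (c · x) ≡ b → F x))

IsProperFace : ∀ {n} → PSet n → PSet n → Set
IsProperFace {n} P F = IsFace P F × Σ (Pt n) (λ y → P y × ¬ F y)

IsFacet : ∀ {n} → PSet n → PSet n → Set₁
IsFacet {n} P F =
    IsProperFace P F
  × Σ (Pt n) F
  × (∀ F' → IsProperFace P F' → (∀ x → F x → F' x) → ∀ x → F' x → F x)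

IsVertex : ∀ {n} → PSet n → Pt n → Set
IsVertex {n} P v = IsFace P (λ x → x ≡ v)

InRelInt : ∀ {n} → PSet n → Pt n → Set₁
InRelInt P x = P x × (∀ F → IsProperFace P F → ¬ F x)

InRelBoundary : ∀ {n} → PSet n → Pt n → Set₁
InRelBoundary P x = P x × Σ _ (λ F → IsProperFace P F × F x)

ι : ℤ → ℚ
ι z = z / 1

toQ : ∀ {n} → (Fin n → ℤ) → Pt n
toQ z k = ι (z k)

IsLattice : ∀ {n} → Pt n → Set
IsLattice {n} x = Σ (Fin n → ℤ) λ z → ∀ k → x k ≡ ι (z k)

IsPrimitive : ∀ {n} → Pt n → Set
IsPrimitive {n} x =
  IsLattice x ×
  (∀ (d : ℕ) → d ≥ 2 → ¬ Σ (Fin n → ℤ) λ w → ∀ k → x k ≡ ι (+ d) * ι (w k))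

-- Terminal reflexive lattice polytopes (intrinsic formulation, i.e.
-- with respect to the lattice  aff(P) ∩ ℤⁿ, which is what
-- "unimodularly equivalent to a full-dimensional polytope" amounts to):
--  * the origin lies in the relative interior;
--  * every vertex is primitive;
--  * every lattice point on the relative boundary is a vertex;
--  * every facet has lattice distance one from the origin, i.e. it is
--    cut out by a valid inequality a·x ≤ 1 with a ∈ ℤⁿ.

IsTerminalReflexive : ∀ {n} → PSet n → Set₁
IsTerminalReflexive {n} P =
    InRelInt P 𝟎
  × (∀ v → IsVertex P v → IsPrimitive v)
  × (∀ x → IsLattice x → InRelBoundary P x → IsVertex P x)
  × (∀ F → IsFacet P F →
       Σ (Fin n → ℤ) λ a →
           (∀ x → P x → (toQ a · x) ≤ 1ℚ)
         × (∀ x → (F x → P x × (toQ a · x) ≡ 1ℚ)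
                × (P x × (toQ a · x) ≡ 1ℚ → F x)))

-- A proper face F = {x ∈ 𝒜_G : c·x = b} of 𝒜_G is the convex hull of the
-- vertices e_i − e_j it contains, i.e. 𝒜_H for the subgraph H of arcs with
-- c_i − c_j = b.  The origin lies in the relative interior, hence on no
-- proper face, so b ≠ 0; then c strictly increases (b < 0) or decreases
-- (b > 0) along every arc of H, which rules out directed cycles.
module Submission where

open import Defs
open import Data.Nat using (ℕ; zero; suc)
open import Data.Fin using (Fin; zero; suc) renaming (_≟_ to _≟ᶠ_)
open import Data.Fin.Properties using (suc-injective)
open import Data.Bool using (true; false; _∧_)
open import Data.Product using (Σ; _×_; _,_; proj₁; proj₂)
open import Data.Sum using (_⊎_; inj₁; inj₂)
open import Function using (_∘_; flip)
open import Level using (Level; 0ℓ)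
open import Relation.Nullary using (¬_; yes; no; does; contradiction)
open import Relation.Binary using (Rel; Irreflexive; Transitive; Decidable)
open import Relation.Binary.Definitions using (tri<; tri≈; tri>)
open import Relation.Binary.PropositionalEquality
open import Relation.Binary.Construct.Closure.Transitive using (TransClosure; [_]; _∷_)
open import Data.Rational
  using (ℚ; _+_; _*_; _-_; -_; _≤_; _<_; 0ℚ; 1ℚ; 1/_; ≢-nonZero; nonNegative)
import Data.Rational.Properties as ℚ
open import Data.Rational.Solver using (module +-*-Solver)
open +-*-Solver using (solve; _:+_; _:-_; _:*_; _:=_)

private
  variable
    ℓ : Level
    n : ℕ

sumF-cong : {f g : Fin n → ℚ} → (∀ k → f k ≡ g k) → sumF f ≡ sumF g
sumF-cong {zero}  f≡g = refl
sumF-cong {suc n} f≡g = cong₂ _+_ (f≡g zero) (sumF-cong (f≡g ∘ suc))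

sumF-zero : sumF {n} (λ _ → 0ℚ) ≡ 0ℚ
sumF-zero {zero}  = refl
sumF-zero {suc n} = cong (0ℚ +_) (sumF-zero {n})

sumF-single : (i : Fin n) (f : Fin n → ℚ) → (∀ k → k ≢ i → f k ≡ 0ℚ) → sumF f ≡ f i
sumF-single {suc n} zero f f≡0 = begin
  f zero + sumF (f ∘ suc) ≡⟨ cong (f zero +_) (trans (sumF-cong (λ k → f≡0 (suc k) λ ())) (sumF-zero {n})) ⟩
  f zero + 0ℚ             ≡⟨ ℚ.+-identityʳ (f zero) ⟩
  f zero                  ∎
  where open ≡-Reasoning
sumF-single (suc i) f f≡0 = begin
  f zero + sumF (f ∘ suc) ≡⟨ cong₂ _+_ (f≡0 zero λ ()) (sumF-single i (f ∘ suc) (λ k k≢i → f≡0 (suc k) (k≢i ∘ suc-injective))) ⟩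
  0ℚ + f (suc i)          ≡⟨ ℚ.+-identityˡ (f (suc i)) ⟩
  f (suc i)               ∎
  where open ≡-Reasoning

sumF-+ : (f g : Fin n → ℚ) → sumF (λ k → f k + g k) ≡ sumF f + sumF g
sumF-+ {zero}  f g = refl
sumF-+ {suc n} f g =
  trans (cong (f zero + g zero +_) (sumF-+ (f ∘ suc) (g ∘ suc)))
        (solve 4 (λ a b c d → (a :+ b) :+ (c :+ d) := (a :+ c) :+ (b :+ d)) refl
           (f zero) (g zero) (sumF (f ∘ suc)) (sumF (g ∘ suc)))

sumF-neg : (f : Fin n → ℚ) → sumF (λ k → - f k) ≡ - sumF f
sumF-neg {zero}  f = refl
sumF-neg {suc n} f = trans (cong (- f zero +_) (sumF-neg (f ∘ suc)))
                           (sym (ℚ.neg-distrib-+ (f zero) (sumF (f ∘ suc))))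

sumF-- : (f g : Fin n → ℚ) → sumF (λ k → f k - g k) ≡ sumF f - sumF g
sumF-- f g = trans (sumF-+ f (λ k → - g k)) (cong (sumF f +_) (sumF-neg g))

sumF-*ˡ : (a : ℚ) (f : Fin n → ℚ) → sumF (λ k → a * f k) ≡ a * sumF f
sumF-*ˡ {zero}  a f = sym (ℚ.*-zeroʳ a)
sumF-*ˡ {suc n} a f = trans (cong (a * f zero +_) (sumF-*ˡ a (f ∘ suc)))
                            (sym (ℚ.*-distribˡ-+ a (f zero) (sumF (f ∘ suc))))

sumF-comm : ∀ {m} (f : Fin m → Fin n → ℚ) →
  sumF (λ i → sumF (λ j → f i j)) ≡ sumF (λ j → sumF (λ i → f i j))
sumF-comm {n} {zero}  f = sym (sumF-zero {n})
sumF-comm {m = suc m} f =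
  trans (cong (sumF (f zero) +_) (sumF-comm (f ∘ suc)))
        (sym (sumF-+ (f zero) (λ j → sumF (λ i → f (suc i) j))))

sumF-nonNeg : (f : Fin n → ℚ) → (∀ k → 0ℚ ≤ f k) → 0ℚ ≤ sumF f
sumF-nonNeg {zero}  f f≥0 = ℚ.≤-refl
sumF-nonNeg {suc n} f f≥0 = ℚ.+-mono-≤ (f≥0 zero) (sumF-nonNeg (f ∘ suc) (f≥0 ∘ suc))

sumF-nonNeg-≡0 : (f : Fin n → ℚ) → (∀ k → 0ℚ ≤ f k) → sumF f ≡ 0ℚ → ∀ k → f k ≡ 0ℚ
sumF-nonNeg-≡0 {suc n} f f≥0 Σf≡0 = λ where
    zero    → f₀≡0
    (suc k) → sumF-nonNeg-≡0 (f ∘ suc) (f≥0 ∘ suc) rest≡0 k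
  where
  f₀≤0 : f zero ≤ 0ℚ
  f₀≤0 = subst₂ _≤_ (ℚ.+-identityʳ (f zero)) Σf≡0
           (ℚ.+-monoʳ-≤ (f zero) (sumF-nonNeg (f ∘ suc) (f≥0 ∘ suc)))
  f₀≡0 : f zero ≡ 0ℚ
  f₀≡0 = ℚ.≤-antisym f₀≤0 (f≥0 zero)
  rest≡0 : sumF (f ∘ suc) ≡ 0ℚ
  rest≡0 = trans (sym (ℚ.+-identityˡ _)) (trans (cong (_+ sumF (f ∘ suc)) (sym f₀≡0)) Σf≡0)

sumF² : (Fin n → Fin n → ℚ) → ℚ
sumF² f = sumF (λ i → sumF (f i))

sumF²-cong : {f g : Fin n → Fin n → ℚ} → (∀ i j → f i j ≡ g i j) → sumF² f ≡ sumF² g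
sumF²-cong f≡g = sumF-cong (sumF-cong ∘ f≡g)

sumF²-single : (i j : Fin n) (f : Fin n → Fin n → ℚ) →
  (∀ p q → p ≢ i ⊎ q ≢ j → f p q ≡ 0ℚ) → sumF² f ≡ f i j
sumF²-single {n} i j f f≡0 =
  trans (sumF-single i (sumF ∘ f)
           (λ p p≢i → trans (sumF-cong (λ q → f≡0 p q (inj₁ p≢i))) (sumF-zero {n})))
        (sumF-single j (f i) (λ q q≢j → f≡0 i q (inj₂ q≢j)))

sumF²-*ˡ : (a : ℚ) (f : Fin n → Fin n → ℚ) → sumF² (λ i j → a * f i j) ≡ a * sumF² f
sumF²-*ˡ a f = trans (sumF-cong (λ i → sumF-*ˡ a (f i))) (sumF-*ˡ a (sumF ∘ f))

sumF²-- : (f g : Fin n → Fin n → ℚ) → sumF² (λ i j → f i j - g i j) ≡ sumF² f - sumF² g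
sumF²-- f g = trans (sumF-cong (λ i → sumF-- (f i) (g i))) (sumF-- (sumF ∘ f) (sumF ∘ g))

sumF²-nonNeg-≡0 : (f : Fin n → Fin n → ℚ) → (∀ i j → 0ℚ ≤ f i j) →
  sumF² f ≡ 0ℚ → ∀ i j → f i j ≡ 0ℚ
sumF²-nonNeg-≡0 f f≥0 Σf≡0 i = sumF-nonNeg-≡0 (f i) (f≥0 i)
  (sumF-nonNeg-≡0 (sumF ∘ f) (λ i → sumF-nonNeg (f i) (f≥0 i)) Σf≡0 i)

*-nonNeg : {p q : ℚ} → 0ℚ ≤ p → 0ℚ ≤ q → 0ℚ ≤ p * q
*-nonNeg {p} {q} p≥0 q≥0 =
  subst (_≤ p * q) (ℚ.*-zeroʳ p) (ℚ.*-monoˡ-≤-nonNeg p {{nonNegative p≥0}} q≥0)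

≤⇒0≤- : {p q : ℚ} → p ≤ q → 0ℚ ≤ q - p
≤⇒0≤- {p} {q} p≤q = subst (_≤ q - p) (ℚ.+-inverseʳ p) (ℚ.+-monoˡ-≤ (- p) p≤q)

p-q≡r⇒p≡r+q : {p q r : ℚ} → p - q ≡ r → p ≡ r + q
p-q≡r⇒p≡r+q {p} {q} p-q≡r =
  trans (solve 2 (λ a b → a := (a :- b) :+ b) refl p q) (cong (_+ q) p-q≡r)

p*q≡0⇒q≢0⇒p≡0 : (p q : ℚ) → p * q ≡ 0ℚ → q ≢ 0ℚ → p ≡ 0ℚ
p*q≡0⇒q≢0⇒p≡0 p q pq≡0 q≢0 = begin
  p                   ≡⟨ sym (ℚ.*-identityʳ p) ⟩
  p * 1ℚ              ≡⟨ cong (p *_) (sym (ℚ.*-inverseʳ q)) ⟩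
  p * (q * 1/ q)      ≡⟨ sym (ℚ.*-assoc p q (1/ q)) ⟩
  (p * q) * 1/ q      ≡⟨ cong (_* 1/ q) pq≡0 ⟩
  0ℚ * 1/ q           ≡⟨ ℚ.*-zeroˡ (1/ q) ⟩
  0ℚ                  ∎
  where
  open ≡-Reasoning
  instance _ = ≢-nonZero q≢0

e-diag : (i : Fin n) → e i i ≡ 1ℚ
e-diag i with i ≟ᶠ i
... | yes _   = refl
... | no i≢i  = contradiction refl i≢i

e-offdiag : {i k : Fin n} → k ≢ i → e i k ≡ 0ℚ
e-offdiag {i = i} {k} k≢i with k ≟ᶠ i
... | yes k≡i = contradiction k≡i k≢i
... | no _    = refl

e-nonNeg : (i k : Fin n) → 0ℚ ≤ e i k
e-nonNeg i k with k ≟ᶠ i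
... | yes _ = ℚ.nonNegative⁻¹ 1ℚ
... | no _  = ℚ.≤-refl

sumF-e* : (i : Fin n) (f : Fin n → ℚ) → sumF (λ k → e i k * f k) ≡ f i
sumF-e* i f =
  trans (sumF-single i _ (λ k k≢i → trans (cong (_* f k) (e-offdiag k≢i)) (ℚ.*-zeroˡ (f k))))
        (trans (cong (_* f i) (e-diag i)) (ℚ.*-identityˡ (f i)))

combination : (Fin n → Fin n → ℚ) → Pt n
combination l k = sumF² (λ i j → l i j * eij i j k)

·-𝟎 : (c : Pt n) → c · 𝟎 ≡ 0ℚ
·-𝟎 {n} c = trans (sumF-cong (λ k → ℚ.*-zeroʳ (c k))) (sumF-zero {n})

·-eij : (c : Pt n) (i j : Fin n) → c · eij i j ≡ c i - c j
·-eij c i j = begin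
  sumF (λ k → c k * (e i k - e j k))
    ≡⟨ sumF-cong (λ k → solve 3 (λ a b d → a :* (b :- d) := b :* a :- d :* a) refl (c k) (e i k) (e j k)) ⟩
  sumF (λ k → e i k * c k - e j k * c k)
    ≡⟨ sumF-- (λ k → e i k * c k) (λ k → e j k * c k) ⟩
  sumF (λ k → e i k * c k) - sumF (λ k → e j k * c k)
    ≡⟨ cong₂ _-_ (sumF-e* i c) (sumF-e* j c) ⟩
  c i - c j
    ∎
  where open ≡-Reasoning

·-combination : (c x : Pt n) (l : Fin n → Fin n → ℚ) → (∀ k → x k ≡ combination l k) →
  c · x ≡ sumF² (λ i j → l i j * (c i - c j))
·-combination c x l x≡ = begin
  sumF (λ k → c k * x k)
    ≡⟨ sumF-cong (λ k → trans (cong (c k *_) (x≡ k)) (sym (sumF²-*ˡ (c k) (λ i j → l i j * eij i j k)))) ⟩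
  sumF (λ k → sumF² (λ i j → c k * (l i j * eij i j k)))
    ≡⟨ sumF-comm (λ k i → sumF (λ j → c k * (l i j * eij i j k))) ⟩
  sumF (λ i → sumF (λ k → sumF (λ j → c k * (l i j * eij i j k))))
    ≡⟨ sumF-cong (λ i → sumF-comm (λ k j → c k * (l i j * eij i j k))) ⟩
  sumF² (λ i j → sumF (λ k → c k * (l i j * eij i j k)))
    ≡⟨ sumF²-cong (λ i j → sumF-cong (λ k → solve 3 (λ a b d → a :* (b :* d) := b :* (a :* d)) refl (c k) (l i j) (eij i j k))) ⟩
  sumF² (λ i j → sumF (λ k → l i j * (c k * eij i j k)))
    ≡⟨ sumF²-cong (λ i j → trans (sumF-*ˡ (l i j) (λ k → c k * eij i j k)) (cong (l i j *_) (·-eij c i j))) ⟩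
  sumF² (λ i j → l i j * (c i - c j))
    ∎
  where open ≡-Reasoning

arcWeight : (i j p q : Fin n) → ℚ
arcWeight i j p q = e i p * e j q

arcWeight-offdiag : {i j p q : Fin n} → p ≢ i ⊎ q ≢ j → arcWeight i j p q ≡ 0ℚ
arcWeight-offdiag {j = j} {q = q} (inj₁ p≢i) = trans (cong (_* e j q) (e-offdiag p≢i)) (ℚ.*-zeroˡ (e j q))
arcWeight-offdiag {i = i} {p = p} (inj₂ q≢j) = trans (cong (e i p *_) (e-offdiag q≢j)) (ℚ.*-zeroʳ (e i p))

arcWeight-diag : (i j : Fin n) → arcWeight i j i j ≡ 1ℚ
arcWeight-diag i j = cong₂ _*_ (e-diag i) (e-diag j)

eij∈EdgePolytope : (G : Digraph n) {i j : Fin n} → Arc G i j → EdgePolytope G (eij i j)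
eij∈EdgePolytope G {i} {j} ij∈G = arcWeight i j , nonNeg , offG , total , point
  where
  nonNeg : ∀ p q → 0ℚ ≤ arcWeight i j p q
  nonNeg p q = *-nonNeg (e-nonNeg i p) (e-nonNeg j q)
  offG : ∀ p q → arc G p q ≡ false → arcWeight i j p q ≡ 0ℚ
  offG p q pq∉G = arcWeight-offdiag (non-arc≢ij p q pq∉G)
    where
    non-arc≢ij : ∀ p q → arc G p q ≡ false → p ≢ i ⊎ q ≢ j
    non-arc≢ij p q pq∉G with p ≟ᶠ i | q ≟ᶠ j
    ... | yes refl | yes refl = contradiction (trans (sym ij∈G) pq∉G) λ ()
    ... | yes _    | no q≢j  = inj₂ q≢j
    ... | no p≢i   | _       = inj₁ p≢i
  total : sumF² (arcWeight i j) ≡ 1ℚ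
  total = trans (sumF²-single i j _ (λ _ _ → arcWeight-offdiag)) (arcWeight-diag i j)
  point : ∀ k → eij i j k ≡ combination (arcWeight i j) k
  point k = sym (begin
    combination (arcWeight i j) k ≡⟨ sumF²-single i j _ (λ p q pq≢ij →
                                       trans (cong (_* eij p q k) (arcWeight-offdiag pq≢ij)) (ℚ.*-zeroˡ (eij p q k))) ⟩
    arcWeight i j i j * eij i j k ≡⟨ cong (_* eij i j k) (arcWeight-diag i j) ⟩
    1ℚ * eij i j k                ≡⟨ ℚ.*-identityˡ _ ⟩
    eij i j k                     ∎)
    where open ≡-Reasoning

arc? : (G : Digraph n) (i j : Fin n) → Arc G i j ⊎ arc G i j ≡ false
arc? G i j with arc G i j
... | true  = inj₁ refl
... | false = inj₂ refl

EdgePolytope-mono : {G H : Digraph n} → H ⊆G G → ∀ x → EdgePolytope H x → EdgePolytope G x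
EdgePolytope-mono {G = G} {H} H⊆G x (l , l≥0 , offH , total , x≡) = l , l≥0 , offG , total , x≡
  where
  offG : ∀ i j → arc G i j ≡ false → l i j ≡ 0ℚ
  offG i j ij∉G with arc? H i j
  ... | inj₂ ij∉H = offH i j ij∉H
  ... | inj₁ ij∈H = contradiction (trans (sym (H⊆G i j ij∈H)) ij∉G) λ ()

restrict : (G : Digraph n) {P : Rel (Fin n) ℓ} → Decidable P → Digraph n
restrict G P? = record
  { arc    = λ i j → arc G i j ∧ does (P? i j)
  ; noLoop = λ i → cong (_∧ does (P? i i)) (noLoop G i)
  }

module _ (G : Digraph n) {P : Rel (Fin n) ℓ} (P? : Decidable P) where

  Arc-restrict⁻ : ∀ {i j} → Arc (restrict G P?) i j → Arc G i j × P i j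
  Arc-restrict⁻ {i} {j} ij∈H with arc G i j | P? i j
  ... | true | yes Pij = refl , Pij

  restrict-⊆ : restrict G P? ⊆G G
  restrict-⊆ i j = proj₁ ∘ Arc-restrict⁻

  restrict-∉ : ∀ {i j} → arc (restrict G P?) i j ≡ false → Arc G i j → ¬ P i j
  restrict-∉ {i} {j} ij∉H ij∈G with arc G i j | P? i j
  ... | true | no ¬Pij = ¬Pij

increasing⇒acyclic : {A : Set} {_<_ : Rel A ℓ} → Irreflexive _≡_ _<_ → Transitive _<_ →
  (H : Digraph n) (f : Fin n → A) → (∀ {i j} → Arc H i j → f i < f j) → Acyclic H
increasing⇒acyclic {_<_ = _<_} irrefl <-trans H f increasing i cycle = irrefl refl (along cycle)
  where
  along : ∀ {i j} → TransClosure (Arc H) i j → f i < f j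
  along [ ij∈H ]       = increasing ij∈H
  along (ij∈H ∷ path) = <-trans (increasing ij∈H) (along path)

constantDrop⇒acyclic : (H : Digraph n) (c : Pt n) {b : ℚ} → b ≢ 0ℚ →
  (∀ {i j} → Arc H i j → c i - c j ≡ b) → Acyclic H
constantDrop⇒acyclic H c {b} b≢0 drop with ℚ.<-cmp b 0ℚ
... | tri< b<0 _ _ = increasing⇒acyclic ℚ.<-irrefl ℚ.<-trans H c λ {i} {j} ij∈H → begin-strict
  c i      ≡⟨ p-q≡r⇒p≡r+q (drop ij∈H) ⟩
  b + c j  <⟨ ℚ.+-monoˡ-< (c j) b<0 ⟩
  0ℚ + c j ≡⟨ ℚ.+-identityˡ (c j) ⟩
  c j      ∎
  where open ℚ.≤-Reasoning
... | tri≈ _ b≡0 _ = contradiction b≡0 b≢0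
... | tri> _ _ b>0 = increasing⇒acyclic (ℚ.<-irrefl ∘ sym) (flip ℚ.<-trans) H c λ {i} {j} ij∈H → begin-strict
  c j      ≡⟨ ℚ.+-identityˡ (c j) ⟨
  0ℚ + c j <⟨ ℚ.+-monoˡ-< (c j) b>0 ⟩
  b + c j  ≡⟨ p-q≡r⇒p≡r+q (drop ij∈H) ⟨
  c i      ∎
  where open ℚ.≤-Reasoning

DropsBy : Pt n → ℚ → Rel (Fin n) 0ℓ
DropsBy c b i j = c i - c j ≡ b

dropsBy? : (c : Pt n) (b : ℚ) → Decidable (DropsBy c b)
dropsBy? c b i j = c i - c j ℚ.≟ b

FaceGraph : Digraph n → Pt n → ℚ → Digraph n
FaceGraph G c b = restrict G (dropsBy? c b)

module _ (G : Digraph n) (c : Pt n) (b : ℚ) where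

  private
    H = FaceGraph G c b

  FaceGraph-acyclic : b ≢ 0ℚ → Acyclic H
  FaceGraph-acyclic b≢0 = constantDrop⇒acyclic H c b≢0 (proj₂ ∘ Arc-restrict⁻ G (dropsBy? c b))

  EdgePolytope-FaceGraph⁻ : ∀ x → EdgePolytope H x → EdgePolytope G x × c · x ≡ b
  EdgePolytope-FaceGraph⁻ x x∈𝒜H@(l , _ , offH , total , x≡) =
    EdgePolytope-mono {G = G} {H} (restrict-⊆ G (dropsBy? c b)) x x∈𝒜H , (begin
      c · x                               ≡⟨ ·-combination c x l x≡ ⟩
      sumF² (λ i j → l i j * (c i - c j)) ≡⟨ sumF²-cong term ⟩
      sumF² (λ i j → b * l i j)           ≡⟨ sumF²-*ˡ b l ⟩
      b * sumF² l                         ≡⟨ cong (b *_) total ⟩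
      b * 1ℚ                              ≡⟨ ℚ.*-identityʳ b ⟩
      b                                   ∎)
    where
    open ≡-Reasoning
    term : ∀ i j → l i j * (c i - c j) ≡ b * l i j
    term i j with arc? H i j
    ... | inj₁ ij∈H = trans (cong (l i j *_) (proj₂ (Arc-restrict⁻ G (dropsBy? c b) ij∈H))) (ℚ.*-comm (l i j) b)
    ... | inj₂ ij∉H = begin
      l i j * (c i - c j) ≡⟨ cong (_* (c i - c j)) (offH i j ij∉H) ⟩
      0ℚ * (c i - c j)    ≡⟨ ℚ.*-zeroˡ (c i - c j) ⟩
      0ℚ                  ≡⟨ ℚ.*-zeroʳ b ⟨
      b * 0ℚ              ≡⟨ cong (b *_) (offH i j ij∉H) ⟨
      b * l i j           ∎

  -- The weights satisfy Σ λ_ij (b − (c_i − c_j)) = b − c · x = 0 with every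
  -- term nonnegative, so λ vanishes on the arcs where the inequality is strict.
  EdgePolytope-FaceGraph⁺ : (∀ y → EdgePolytope G y → c · y ≤ b) →
    ∀ x → EdgePolytope G x → c · x ≡ b → EdgePolytope H x
  EdgePolytope-FaceGraph⁺ valid x (l , l≥0 , offG , total , x≡) c·x≡b = l , l≥0 , offH , total , x≡
    where
    open ≡-Reasoning
    slack : Fin _ → Fin _ → ℚ
    slack i j = b - (c i - c j)
    weighted≥0 : ∀ i j → 0ℚ ≤ l i j * slack i j
    weighted≥0 i j with arc? G i j
    ... | inj₁ ij∈G = *-nonNeg (l≥0 i j)
      (≤⇒0≤- (subst (_≤ b) (·-eij c i j) (valid (eij i j) (eij∈EdgePolytope G ij∈G))))
    ... | inj₂ ij∉G = subst (0ℚ ≤_)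
      (sym (trans (cong (_* slack i j) (offG i j ij∉G)) (ℚ.*-zeroˡ (slack i j)))) ℚ.≤-refl
    weighted-sum : sumF² (λ i j → l i j * slack i j) ≡ 0ℚ
    weighted-sum = begin
      sumF² (λ i j → l i j * slack i j)
        ≡⟨ sumF²-cong (λ i j → solve 4 (λ L B p q → L :* (B :- (p :- q)) := B :* L :- L :* (p :- q)) refl (l i j) b (c i) (c j)) ⟩
      sumF² (λ i j → b * l i j - l i j * (c i - c j))
        ≡⟨ sumF²-- (λ i j → b * l i j) (λ i j → l i j * (c i - c j)) ⟩
      sumF² (λ i j → b * l i j) - sumF² (λ i j → l i j * (c i - c j))
        ≡⟨ cong₂ _-_ (trans (sumF²-*ˡ b l) (cong (b *_) total)) (sym (·-combination c x l x≡)) ⟩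
      b * 1ℚ - c · x
        ≡⟨ cong₂ _-_ (ℚ.*-identityʳ b) c·x≡b ⟩
      b - b
        ≡⟨ ℚ.+-inverseʳ b ⟩
      0ℚ
        ∎
    offH : ∀ i j → arc H i j ≡ false → l i j ≡ 0ℚ
    offH i j ij∉H with arc? G i j
    ... | inj₂ ij∉G = offG i j ij∉G
    ... | inj₁ ij∈G = p*q≡0⇒q≢0⇒p≡0 (l i j) (slack i j)
      (sumF²-nonNeg-≡0 (λ i j → l i j * slack i j) weighted≥0 weighted-sum i j)
      (λ slack≡0 → restrict-∉ G (dropsBy? c b) ij∉H ij∈G (sym (trans (p-q≡r⇒p≡r+q slack≡0) (ℚ.+-identityˡ _))))

lemma3p1 : (n : ℕ) (G : Digraph n) →
    Connected G →
    IsTerminalReflexive (EdgePolytope G) →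
    (F : PSet n) → IsProperFace (EdgePolytope G) F →
    Σ (Digraph n) λ H →
    H ⊆G G × Acyclic H ×
    (∀ x → (F x → EdgePolytope H x) × (EdgePolytope H x → F x))
lemma3p1 n G _ ((𝟎∈𝒜G , 𝟎∉proper) , _) F proper@((c , b , valid , F⇔) , _) =
  FaceGraph G c b , restrict-⊆ G (dropsBy? c b) , FaceGraph-acyclic G c b b≢0 ,
  λ x → (λ x∈F → let (x∈𝒜G , c·x≡b) = proj₁ (F⇔ x) x∈F
                 in EdgePolytope-FaceGraph⁺ G c b valid x x∈𝒜G c·x≡b)
      , proj₂ (F⇔ x) ∘ EdgePolytope-FaceGraph⁻ G c b x
  where
  b≢0 : b ≢ 0ℚ
  b≢0 b≡0 = 𝟎∉proper F proper (proj₂ (F⇔ 𝟎) (𝟎∈𝒜G , trans (·-𝟎 c) (sym b≡0)))
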